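{- For every formula $A$, $\mathbf{EC}_\varepsilon^=\vdash A$ if and only if $\mathbf{EC}_\varepsilon^{=_1}\vdash A$.
   Context: Terms/formulas (no $\forall,\exists$): $t ::= x\mid a\mid f(\vec t)\mid\varepsilon_xA$, $A ::= P(\vec t)\mid t=t'\mid\neg A\mid A\to B\mid A\land B\mid A\lor B$, $\varepsilon_x$ binds $x$, no free bound variables, capture-avoiding substitution. $\mathbf{EC}$: all propositional tautologies, modus ponens. $\mathbf{EQ}$: $t=t$, $s=t\to t=s$, $s=t\to t=u\to s=u$, $\vec s=\vec t\to P\vec s\to P\vec t$, $\vec s=\vec t\to f\vec s=f\vec t$ ($\vec s=\vec t$ abbreviates $\bigwedge_is_i=t_i$). Critical formulas: $A(t)\to A(\varepsilon_xA(x))$. An $\varepsilon$-matrix is an $\varepsilon$-term whose proper subterms are all free variables each occurring exactly once, written $\varepsilon_xA(x;\vec a)$. $\mathbf{EC}_\varepsilon^=$ is $\mathbf{EC}$ plus $\mathbf{EQ}$, critical formulas, and all $\vec u=\vec v\to\varepsilon_xA(x;\vec u)=\varepsilon_xA(x;\vec v)$ ($\varepsilon_xA(x;\vec a)$ an $\varepsilon$-matrix). $\mathbf{EC}_\varepsilon^{=_1}$ is $\mathbf{EC}$ plus $\mathbf{EQ}$, critical formulas, and all $u_i=v\to\varepsilon_xA(x;\vec u)=\varepsilon_xA(x;\vec u_{i\mapsto v})$ ($\varepsilon_xA(x;\vec a)$ an $\varepsilon$-matrix, $\vec u_{i\mapsto v}$ = $\vec u$ with $i$-th entry replaced by $v$).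 -}

module Defs where

open import Data.Nat using (ℕ; zero; suc; _≤_; z≤n; s≤s; _≡ᵇ_)
open import Data.Fin using (Fin; zero; suc; inject≤)
open import Data.Vec using (Vec; []; _∷_)
open import Data.List using (List; []; _∷_; _++_; length)
open import Data.Bool using (Bool; true; false; not; _∧_; _∨_; if_then_else_)
open import Data.Maybe using (Maybe; just; nothing)
import Data.Maybe as Maybe
open import Data.Product using (Σ; _×_)
open import Relation.Binary.PropositionalEquality using (_≡_)
open import Relation.Nullary using (¬_)
open import Data.List.Relation.Unary.Unique.Propositional using (Unique)

record Sig : Set₁ where
  field
    Fun    : Set
    fArity : Fun → ℕ
    Pred   : Set
    pArity : Pred → ℕ

module Lang (S : Sig) where
  open Sig S

  -- Locally nameless syntax.  Free variables a are named by ℕ (fv a);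
  -- bound variables x are de Bruijn indices (bv i).  Term n / Form n may
  -- contain bound-variable indices < n referring to enclosing ε-binders.
  -- Genuine terms/formulas ("no free bound variables") are Term 0 / Form 0.
  data Term (n : ℕ) : Set
  data Form (n : ℕ) : Set

  data Term n where
    bv  : Fin n → Term n
    fv  : ℕ → Term n
    app : (f : Fun) → Vec (Term n) (fArity f) → Term n
    eps : Form (suc n) → Term n      -- ε_x A, x is index 0 in the body

  infixr 4 _⇒_
  infixr 5 _∨'_
  infixr 6 _∧'_
  infix 7 _≐_
  data Form n where
    pred : (P : Pred) → Vec (Term n) (pArity P) → Form n
    _≐_  : Term n → Term n → Form n
    ¬'_  : Form n → Form n
    _⇒_  : Form n → Form n → Form n
    _∧'_ : Form n → Form n → Form n
    _∨'_ : Form n → Form n → Form n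

  -- Weakening (adding outer binders; the identity on the syntax tree)
  wkT  : ∀ {m n} → m ≤ n → Term m → Term n
  wkTs : ∀ {m n k} → m ≤ n → Vec (Term m) k → Vec (Term n) k
  wkF  : ∀ {m n} → m ≤ n → Form m → Form n
  wkT p (bv i) = bv (inject≤ i p)
  wkT p (fv a) = fv a
  wkT p (app f ts) = app f (wkTs p ts)
  wkT p (eps A) = eps (wkF (s≤s p) A)
  wkTs p [] = []
  wkTs p (t ∷ ts) = wkT p t ∷ wkTs p ts
  wkF p (pred P ts) = pred P (wkTs p ts)
  wkF p (s ≐ t) = wkT p s ≐ wkT p t
  wkF p (¬' A) = ¬' wkF p A
  wkF p (A ⇒ B) = wkF p A ⇒ wkF p B
  wkF p (A ∧' B) = wkF p A ∧' wkF p B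
  wkF p (A ∨' B) = wkF p A ∨' wkF p B

  -- The largest index of Fin (suc n) (the outermost binder) ↦ nothing,
  -- every other index i ↦ just i.
  top? : ∀ {n} → Fin (suc n) → Maybe (Fin n)
  top? {zero} zero = nothing
  top? {suc n} zero = just zero
  top? {suc n} (suc i) = Maybe.map suc (top? i)

  -- Substitution of a (closed) term t for the outermost bound variable:
  -- A(x) ↦ A(t).  Capture-avoiding since t has no free bound variables.
  sbT  : ∀ {n} → Term 0 → Term (suc n) → Term n
  sbTs : ∀ {n k} → Term 0 → Vec (Term (suc n)) k → Vec (Term n) k
  sbF  : ∀ {n} → Term 0 → Form (suc n) → Form n
  sbT t (bv i) with top? i
  ... | nothing = wkT z≤n t
  ... | just j  = bv j
  sbT t (fv a) = fv a
  sbT t (app f ts) = app f (sbTs t ts)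
  sbT t (eps A) = eps (sbF t A)
  sbTs t [] = []
  sbTs t (s ∷ ss) = sbT t s ∷ sbTs t ss
  sbF t (pred P ts) = pred P (sbTs t ts)
  sbF t (s ≐ u) = sbT t s ≐ sbT t u
  sbF t (¬' A) = ¬' sbF t A
  sbF t (A ⇒ B) = sbF t A ⇒ sbF t B
  sbF t (A ∧' B) = sbF t A ∧' sbF t B
  sbF t (A ∨' B) = sbF t A ∨' sbF t B

  fsT  : ∀ {n} → (ℕ → Term 0) → Term n → Term n
  fsTs : ∀ {n k} → (ℕ → Term 0) → Vec (Term n) k → Vec (Term n) k
  fsF  : ∀ {n} → (ℕ → Term 0) → Form n → Form n
  fsT σ (bv i) = bv i
  fsT σ (fv a) = wkT z≤n (σ a)
  fsT σ (app f ts) = app f (fsTs σ ts)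
  fsT σ (eps A) = eps (fsF σ A)
  fsTs σ [] = []
  fsTs σ (t ∷ ts) = fsT σ t ∷ fsTs σ ts
  fsF σ (pred P ts) = pred P (fsTs σ ts)
  fsF σ (s ≐ t) = fsT σ s ≐ fsT σ t
  fsF σ (¬' A) = ¬' fsF σ A
  fsF σ (A ⇒ B) = fsF σ A ⇒ fsF σ B
  fsF σ (A ∧' B) = fsF σ A ∧' fsF σ B
  fsF σ (A ∨' B) = fsF σ A ∨' fsF σ B

  fvsT  : ∀ {n} → Term n → List ℕ
  fvsTs : ∀ {n k} → Vec (Term n) k → List ℕ
  fvsF  : ∀ {n} → Form n → List ℕ
  fvsT (bv i) = []
  fvsT (fv a) = a ∷ []
  fvsT (app f ts) = fvsTs ts
  fvsT (eps A) = fvsF A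
  fvsTs [] = []
  fvsTs (t ∷ ts) = fvsT t ++ fvsTs ts
  fvsF (pred P ts) = fvsTs ts
  fvsF (s ≐ t) = fvsT s ++ fvsT t
  fvsF (¬' A) = fvsF A
  fvsF (A ⇒ B) = fvsF A ++ fvsF B
  fvsF (A ∧' B) = fvsF A ++ fvsF B
  fvsF (A ∨' B) = fvsF A ++ fvsF B

  -- A term occurrence s : Term n (inside n binders) is a genuine (closed)
  -- subterm iff it contains no bound variable bound outside of it,
  -- i.e. it is the weakening of some Term 0.
  ClosedT : ∀ {n} → Term n → Set
  ClosedT {n} s = Σ (Term 0) (λ s₀ → wkT z≤n s₀ ≡ s)

  -- MatF A: every closed term occurring in A is a free variable.
  data MatT {n} : Term n → Set
  data MatTs {n} : ∀ {k} → Vec (Term n) k → Set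
  data MatF {n} : Form n → Set
  data MatT {n} where
    bv  : ∀ i → MatT (bv i)
    fv  : ∀ a → MatT (fv a)
    app : ∀ f ts → ¬ ClosedT (app f ts) → MatTs ts → MatT (app f ts)
    eps : ∀ A → ¬ ClosedT (eps A) → MatF A → MatT (eps A)
  data MatTs {n} where
    []  : MatTs []
    _∷_ : ∀ {k t} {ts : Vec (Term n) k} → MatT t → MatTs ts → MatTs (t ∷ ts)
  data MatF {n} where
    pred : ∀ P ts → MatTs ts → MatF (pred P ts)
    eq   : ∀ {s t} → MatT s → MatT t → MatF (s ≐ t)
    neg  : ∀ {A} → MatF A → MatF (¬' A)
    imp  : ∀ {A B} → MatF A → MatF B → MatF (A ⇒ B)
    and  : ∀ {A B} → MatF A → MatF B → MatF (A ∧' B)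
    or   : ∀ {A B} → MatF A → MatF B → MatF (A ∨' B)

  -- ε_x A is an ε-matrix: all its proper subterms are free variables,
  -- each occurring exactly once.  Its parameters a⃗ = fvsF A.
  IsEpsMatrix : Form 1 → Set
  IsEpsMatrix A = MatF A × Unique (fvsF A)

  -- a⃗ ↦ u⃗ as a substitution (a⃗ distinct for matrices)
  assign : (as : List ℕ) → Vec (Term 0) (length as) → ℕ → Term 0
  assign [] [] a = fv a
  assign (b ∷ bs) (u ∷ us) a = if a ≡ᵇ b then u else assign bs us a

  inst : (A : Form 1) → Vec (Term 0) (length (fvsF A)) → Term 0
  inst A us = eps (fsF (assign (fvsF A) us) A)

  -- s⃗ = t⃗ → B, with s⃗ = t⃗ the conjunction ⋀ᵢ sᵢ = tᵢ (right-nested);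
  -- for empty s⃗, t⃗ the formula is just B.
  eqs : ∀ {k} → Vec (Term 0) k → Vec (Term 0) k → List (Form 0)
  eqs [] [] = []
  eqs (s ∷ ss) (t ∷ ts) = (s ≐ t) ∷ eqs ss ts

  bigAnd : Form 0 → List (Form 0) → Form 0
  bigAnd C [] = C
  bigAnd C (D ∷ Ds) = C ∧' bigAnd D Ds

  guard : List (Form 0) → Form 0 → Form 0
  guard [] B = B
  guard (C ∷ Cs) B = bigAnd C Cs ⇒ B

  eval : (Form 0 → Bool) → Form 0 → Bool
  eval v (pred P ts) = v (pred P ts)
  eval v (s ≐ t) = v (s ≐ t)
  eval v (¬' A) = not (eval v A)
  eval v (A ⇒ B) = not (eval v A) ∨ eval v B
  eval v (A ∧' B) = eval v A ∧ eval v B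
  eval v (A ∨' B) = eval v A ∨ eval v B

  Tautology : Form 0 → Set
  Tautology A = (v : Form 0 → Bool) → eval v A ≡ true

  data EQ : Form 0 → Set where
    eq-refl  : ∀ t → EQ (t ≐ t)
    eq-sym   : ∀ s t → EQ (s ≐ t ⇒ t ≐ s)
    eq-trans : ∀ s t u → EQ (s ≐ t ⇒ t ≐ u ⇒ s ≐ u)
    eq-pred  : ∀ P (ss ts : Vec (Term 0) (pArity P)) →
               EQ (guard (eqs ss ts) (pred P ss ⇒ pred P ts))
    eq-fun   : ∀ f (ss ts : Vec (Term 0) (fArity f)) →
               EQ (guard (eqs ss ts) (app f ss ≐ app f ts))

  data Critical : Form 0 → Set where
    crit : ∀ (A : Form 1) (t : Term 0) → Critical (sbF t A ⇒ sbF (eps A) A)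

  data AxEq : Form 0 → Set where
    eqax  : ∀ {B} → EQ B → AxEq B
    critax : ∀ {B} → Critical B → AxEq B
    epsext : ∀ (A : Form 1) → IsEpsMatrix A →
             (us vs : Vec (Term 0) (length (fvsF A))) →
             AxEq (guard (eqs us vs) (inst A us ≐ inst A vs))

  data AxEq₁ : Form 0 → Set where
    eqax  : ∀ {B} → EQ B → AxEq₁ B
    critax : ∀ {B} → Critical B → AxEq₁ B
    epsext₁ : ∀ (A : Form 1) → IsEpsMatrix A →
              (us : Vec (Term 0) (length (fvsF A))) →
              (i : Fin (length (fvsF A))) (v : Term 0) →
              AxEq₁ (Data.Vec.lookup us i ≐ v ⇒
                     inst A us ≐ inst A (us Data.Vec.[ i ]≔ v))

  data _⊢_ (Ax : Form 0 → Set) : Form 0 → Set where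
    taut : ∀ {A} → Tautology A → Ax ⊢ A
    ax   : ∀ {A} → Ax A → Ax ⊢ A
    mp   : ∀ {A B} → Ax ⊢ A → Ax ⊢ (A ⇒ B) → Ax ⊢ B

module Submission where

-- The two ε-equality calculi prove the same formulas because each one's
-- extra axiom scheme is derivable in the other; everything else (tautologies,
-- EQ, critical formulas, modus ponens) is shared.
--
--  * Multi-argument ε-extensionality  u⃗ = v⃗ → ε(u⃗) = ε(v⃗)  follows from the
--    one-argument instances by changing one argument at a time and chaining
--    the equalities with transitivity (`congruence-from-single`).
--  * Conversely, the one-argument instance  uᵢ = v → ε(u⃗) = ε(u⃗[i↦v])  is the
--    multi-argument instance for the vectors u⃗ and u⃗[i↦v], whose equations
--    are all reflexivities except the i-th (`single-from-congruence`).
--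
-- Both arguments only move hypotheses around propositionally.  To keep this
-- painless we reason semantically: a guarded formula  s⃗ = t⃗ → B  is true
-- under a valuation iff B is true whenever all its equations are, and any
-- formula semantically entailed by derivable formulas is derivable
-- (`entailment`), since the corresponding implication is a tautology.

open import Defs
open import Data.Bool using (Bool; true; false; not; _∧_; _∨_)
open import Data.Fin using (zero; suc)
open import Data.List using ([]; _∷_)
open import Data.List.Relation.Unary.All using (All; []; _∷_)
open import Data.Product using (_×_; _,_)
open import Data.Vec using (Vec; []; _∷_; lookup; _[_]≔_)
open import Relation.Binary.PropositionalEquality using (_≡_; refl)

module Truth where

  ⇒-intro : ∀ {a b} → (a ≡ true → b ≡ true) → (not a ∨ b) ≡ true
  ⇒-intro {false} f = refl
  ⇒-intro {true}  f = f refl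

  ⇒-elim : ∀ {a b} → (not a ∨ b) ≡ true → a ≡ true → b ≡ true
  ⇒-elim {true} h refl = h

  ∧-intro : ∀ {a b} → a ≡ true → b ≡ true → (a ∧ b) ≡ true
  ∧-intro refl refl = refl

  ∧-elim : ∀ {a b} → (a ∧ b) ≡ true → a ≡ true × b ≡ true
  ∧-elim {true} {true} refl = refl , refl

module Proof (S : Sig) where
  open Lang S
  open Truth

  _⊨_ : (Form 0 → Bool) → Form 0 → Set
  v ⊨ A = eval v A ≡ true

  bigAnd-intro : ∀ {v} C L → All (v ⊨_) (C ∷ L) → v ⊨ bigAnd C L
  bigAnd-intro C []       (c ∷ [])  = c
  bigAnd-intro C (D ∷ Ds) (c ∷ ds) = ∧-intro c (bigAnd-intro D Ds ds)

  bigAnd-elim : ∀ {v} C L → v ⊨ bigAnd C L → All (v ⊨_) (C ∷ L)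
  bigAnd-elim C []       c = c ∷ []
  bigAnd-elim C (D ∷ Ds) h with ∧-elim h
  ... | c , ds = c ∷ bigAnd-elim D Ds ds

  guard-intro : ∀ {v} Γ B → (All (v ⊨_) Γ → v ⊨ B) → v ⊨ guard Γ B
  guard-intro []       B f = f []
  guard-intro (C ∷ Cs) B f = ⇒-intro λ h → f (bigAnd-elim C Cs h)

  guard-elim : ∀ {v} Γ B → v ⊨ guard Γ B → All (v ⊨_) Γ → v ⊨ B
  guard-elim []       B h []       = h
  guard-elim (C ∷ Cs) B h (c ∷ cs) = ⇒-elim h (bigAnd-intro C Cs (c ∷ cs))

  -- Every formula semantically entailed by derivable formulas is derivable:
  -- Γ → B is a tautology, and its hypotheses are discharged by modus ponens.
  entailment : ∀ {Ax B} Γ → (∀ v → All (v ⊨_) Γ → v ⊨ B) →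
               All (Ax ⊢_) Γ → Ax ⊢ B
  entailment {Ax} {B} Γ f ps = discharge Γ ps (taut λ v → guard-intro Γ B (f v))
    where
      -- C → (C ∷ Δ → B) → (Δ → B) is a tautology; use it for each hypothesis.
      discharge : ∀ Δ → All (Ax ⊢_) Δ → Ax ⊢ guard Δ B → Ax ⊢ B
      discharge []       []       g = g
      discharge (C ∷ Cs) (c ∷ cs) g = discharge Cs cs (mp c (mp g (taut λ v →
        ⇒-intro λ h → ⇒-intro λ c′ → guard-intro Cs B λ cs′ →
          guard-elim (C ∷ Cs) B h (c′ ∷ cs′))))

  eqs-refl : ∀ {k} {P : Form 0 → Set} → (∀ t → P (t ≐ t)) →
             (us : Vec (Term 0) k) → All P (eqs us us)
  eqs-refl r []       = []
  eqs-refl r (u ∷ us) = r u ∷ eqs-refl r us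

  eqs-update : ∀ {k} {P : Form 0 → Set} (us : Vec (Term 0) k) i w →
               All P (eqs us us) → P (lookup us i ≐ w) →
               All P (eqs us (us [ i ]≔ w))
  eqs-update (u ∷ us) zero    w (_ ∷ rs) e = e ∷ rs
  eqs-update (u ∷ us) (suc i) w (r ∷ rs) e = r ∷ eqs-update us i w rs e

  module Congruence (Ax : Form 0 → Set) (eqax : ∀ {B} → EQ B → Ax B) where

    ≐-refl : ∀ t → Ax ⊢ (t ≐ t)
    ≐-refl t = ax (eqax (eq-refl t))

    ≐-trans : ∀ s t u → Ax ⊢ (s ≐ t ⇒ t ≐ u ⇒ s ≐ u)
    ≐-trans s t u = ax (eqax (eq-trans s t u))

    -- If F respects equality in each argument separately, it respects
    -- equality of all arguments at once: change the first argument, then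
    -- the rest by induction, and compose by transitivity.
    congruence-from-single : ∀ {k} (F : Vec (Term 0) k → Term 0) →
      (∀ ws i w → Ax ⊢ (lookup ws i ≐ w ⇒ F ws ≐ F (ws [ i ]≔ w))) →
      ∀ us vs → Ax ⊢ guard (eqs us vs) (F us ≐ F vs)
    congruence-from-single F single [] [] = ≐-refl (F [])
    congruence-from-single F single (u ∷ us) (v ∷ vs) =
      entailment ((first ⇒ second ⇒ whole) ∷ first-step ∷ rest-step ∷ [])
        (λ _ → λ { (tr ∷ h ∷ t ∷ []) →
           guard-intro (eqs (u ∷ us) (v ∷ vs)) whole λ { (e ∷ es) →
             ⇒-elim (⇒-elim tr (⇒-elim h e)) (guard-elim (eqs us vs) second t es) } })
        (≐-trans (F (u ∷ us)) (F (v ∷ us)) (F (v ∷ vs))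
         ∷ single (u ∷ us) zero v
         ∷ congruence-from-single (λ ws → F (v ∷ ws))
             (λ ws i w → single (v ∷ ws) (suc i) w) us vs
         ∷ [])
      where
        first second whole : Form 0
        first  = F (u ∷ us) ≐ F (v ∷ us)
        second = F (v ∷ us) ≐ F (v ∷ vs)
        whole  = F (u ∷ us) ≐ F (v ∷ vs)

        first-step rest-step : Form 0
        first-step = u ≐ v ⇒ first
        rest-step  = guard (eqs us vs) second

    -- A consequence of u⃗ = u⃗[i↦w] follows from uᵢ = w alone, since the
    -- remaining equations are reflexivities.
    single-from-congruence : ∀ {k} (us : Vec (Term 0) k) i w B →
      Ax ⊢ guard (eqs us (us [ i ]≔ w)) B → Ax ⊢ (lookup us i ≐ w ⇒ B)
    single-from-congruence us i w B g =
      entailment (guard (eqs us (us [ i ]≔ w)) B ∷ eqs us us)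
        (λ _ → λ { (h ∷ rs) → ⇒-intro λ e →
           guard-elim (eqs us (us [ i ]≔ w)) B h (eqs-update us i w rs e) })
        (g ∷ eqs-refl ≐-refl us)

  translate : ∀ {Ax₁ Ax₂ : Form 0 → Set} → (∀ {B} → Ax₁ B → Ax₂ ⊢ B) →
              ∀ {A} → Ax₁ ⊢ A → Ax₂ ⊢ A
  translate f (taut t) = taut t
  translate f (ax a)   = f a
  translate f (mp p q) = mp (translate f p) (translate f q)

  AxEq-in-AxEq₁ : ∀ {B} → AxEq B → AxEq₁ ⊢ B
  AxEq-in-AxEq₁ (eqax e)   = ax (eqax e)
  AxEq-in-AxEq₁ (critax c) = ax (critax c)
  AxEq-in-AxEq₁ (epsext A m us vs) =
    congruence-from-single (inst A) (λ ws i w → ax (epsext₁ A m ws i w)) us vs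
    where open Congruence AxEq₁ eqax

  AxEq₁-in-AxEq : ∀ {B} → AxEq₁ B → AxEq ⊢ B
  AxEq₁-in-AxEq (eqax e)   = ax (eqax e)
  AxEq₁-in-AxEq (critax c) = ax (critax c)
  AxEq₁-in-AxEq (epsext₁ A m us i w) =
    single-from-congruence us i w _ (ax (epsext A m us (us [ i ]≔ w)))
    where open Congruence AxEq eqax

mainTheorem9 : (S : Sig) (A : Lang.Form S 0) →
    (Lang._⊢_ S (Lang.AxEq S) A → Lang._⊢_ S (Lang.AxEq₁ S) A) ×
    (Lang._⊢_ S (Lang.AxEq₁ S) A → Lang._⊢_ S (Lang.AxEq S) A)
mainTheorem9 S A = translate AxEq-in-AxEq₁ , translate AxEq₁-in-AxEq
  where open Proof S
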